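{- Let $n$ be a positive multiple of $4$ and consider the vertex-query model on a bipartite vertex set $V = A \,\dot\cup\, B$ with $|A| = |B| = n/2$. For every (deterministic, adaptive) player strategy that uses two rounds, there is a streaming-consistent oracle such that the player's reported matching has approximation ratio at most $1/2$. Consequently, the best approximation ratio achievable in two rounds is $1/2$.
   Context: Vertex-query model: a player and an oracle play a round-based game on a vertex set $V$ with $|V| = n$, known to both. Over the game the oracle makes up a graph $G = (V,E)$ (here required to be bipartite with respect to the given bipartition), which must admit a perfect matching. In each round $i = 1,\dots,r$ the player, possibly depending on all previous answers, submits a query $V_i \subseteq V$, and the oracle returns a set of edges $M_i$ that is a maximal matching in the vertex-induced subgraph $G[V_i] = (V_i, E \cap (V_i \times V_i))$; all answers must be consistent with the single graph $G$. After $r$ rounds the player reports a maximum matching $M_P$ among the edges $\bigcup_{i \le r} M_i$, and the approximation ratio is $|M_P| / (n/2)$. The oracle is streaming-consistent if there is an ordering $\pi$ of $E$ such that for every round $i$, $M_i$ equals the output of the Greedy algorithm (scan edges in order, add an edge whenever both endpoints are currently unmatched) run on the substream of $\pi$ consisting of the edges of $G[V_i]$. -}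

module Defs where

open import Data.Nat using (ℕ; _*_; _≤_)
open import Data.Bool using (Bool; true; false; _∧_; if_then_else_; not)
open import Data.Fin using (Fin)
open import Data.Fin.Properties using () renaming (_≟_ to _≟ᶠ_)
open import Data.Sum using (_⊎_; inj₁; inj₂)
open import Data.Product using (Σ; _×_; _,_; proj₁; proj₂; ∃)
open import Data.Product.Properties using (≡-dec)
open import Data.List using (List; []; _∷_; filter; length)
open import Data.Bool.ListAction using (any)
open import Data.List.Membership.Propositional using (_∈_)
open import Data.List.Relation.Unary.AllPairs using (AllPairs)
open import Data.List.Relation.Unary.Unique.Propositional using (Unique)
open import Relation.Binary.PropositionalEquality using (_≡_; _≢_)
open import Relation.Binary.Definitions using (DecidableEquality)
open import Relation.Nullary.Decidable using (⌊_⌋)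

-- Bipartite vertex set V = A ⊎ B with |A| = |B| = h (h = n/2).
Vertex : ℕ → Set
Vertex h = Fin h ⊎ Fin h

-- An edge of a bipartite graph: (a , b) joins inj₁ a ∈ A with inj₂ b ∈ B.
Edge : ℕ → Set
Edge h = Fin h × Fin h

_≟ₑ_ : ∀ {h} → DecidableEquality (Edge h)
_≟ₑ_ = ≡-dec _≟ᶠ_ _≟ᶠ_

Query : ℕ → Set
Query h = Vertex h → Bool

inQuery : ∀ {h} → Query h → Edge h → Bool
inQuery Q (a , b) = Q (inj₁ a) ∧ Q (inj₂ b)

touches : ∀ {h} → Edge h → Edge h → Bool
touches (a , b) (a' , b') with ⌊ a ≟ᶠ a' ⌋ | ⌊ b ≟ᶠ b' ⌋
... | false | false = false
... | _     | _     = true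

greedyFrom : ∀ {h} → List (Edge h) → List (Edge h) → List (Edge h)
greedyFrom M [] = M
greedyFrom M (e ∷ es) =
  if any (touches e) M then greedyFrom M es else greedyFrom (e ∷ M) es

greedy : ∀ {h} → List (Edge h) → List (Edge h)
greedy = greedyFrom []

-- Streaming-consistent oracle answer: Greedy on the substream of π
-- consisting of the edges of G[Q].
answer : ∀ {h} → List (Edge h) → Query h → List (Edge h)
answer π Q = greedy (filter (λ e → inQuery Q e ≟b true) π)
  where
  open import Data.Bool.Properties using () renaming (_≟_ to _≟b_)

IsMatching : ∀ {h} → List (Edge h) → Set
IsMatching = AllPairs (λ e f → proj₁ e ≢ proj₁ f × proj₂ e ≢ proj₂ f)

-- A streaming-consistent oracle is an ordering π of the edge set E of a
-- bipartite graph G (a duplicate-free list; E is the set of its entries)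
-- such that G admits a perfect matching.
record Oracle (h : ℕ) : Set where
  field
    π        : List (Edge h)
    distinct : Unique π
    perfect  : Σ (List (Edge h)) λ PM →
                 IsMatching PM × (∀ {e} → e ∈ PM → e ∈ π) × length PM ≡ h

-- A deterministic adaptive two-round player: the first query is fixed, the
-- second depends on the first answer M₁ (given to the player as the edge set,
-- i.e. its membership predicate).
record Player (h : ℕ) : Set where
  field
    query₁ : Query h
    query₂ : (Edge h → Bool) → Query h

module _ {h : ℕ} (P : Player h) (O : Oracle h) where
  open Player P
  open Oracle O

  M₁ : List (Edge h)
  M₁ = answer π query₁

  M₂ : List (Edge h)
  M₂ = answer π (query₂ (λ e → ⌊ e ∈? M₁ ⌋))
    where open import Data.List.Membership.DecPropositional (_≟ₑ_ {h}) using (_∈?_)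

  Reportable : List (Edge h) → Set
  Reportable M = IsMatching M × (∀ {e} → e ∈ M → e ∈ M₁ ⊎ e ∈ M₂)

  -- The reported (maximum) matching M_P has ratio |M_P| / (n/2) ≤ 1/2,
  -- i.e. 2 |M| ≤ n/2 = h for every reportable matching M.
  RatioAtMostHalf : Set
  RatioAtMostHalf = ∀ M → Reportable M → 2 * length M ≤ h

  RatioAtLeastHalf : Set
  RatioAtLeastHalf = Σ (List (Edge h)) λ M → Reportable M × h ≤ 2 * length M

-- Upper bound: querying all of V returns a maximal matching; every edge of a
-- perfect matching touches it, so it has at least n/4 edges.
--
-- Lower bound: having seen the first query Q₁, the oracle splits A = R ∪ S and
-- B = T ∪ U into quarters of size n/4 such that R is comparable (under inclusion)
-- with the Q₁-selected part of A, and T with that of B, and streams R × T, then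
-- S × T, then a perfect matching between R and U (so R–U plus S–T is a perfect
-- matching).  For every query, Greedy's answer lies inside A × T or inside R × B.
-- For Q₁ it even lies inside R × T: an answer edge leaving the block would leave
-- a selected vertex on one side of R × T unmatched in the first phase, so Greedy
-- saturated the other side there, contradicting |R| = |T|.  Hence every matching
-- built from both answers has all its B-ends in T or all its A-ends in R.

module Submission where

open import Defs
open import Data.Nat using (ℕ; zero; suc; _+_; _*_; _∸_; _⊓_; _≤_; _<_; z≤n; s≤s)
open import Data.Nat.Properties
  using (+-suc; +-identityʳ; +-mono-≤; *-monoʳ-≤; <-irrefl; m≤m+n; m≤n⇒m⊓n≡m; m+n∸m≡n; ⊓-idem; module ≤-Reasoning)
open import Data.Bool using (true; false; _∧_)
import Data.Bool as Bool
open import Data.Bool.Properties using (∧-conicalˡ; ∧-conicalʳ) renaming (_≟_ to _≟ᵇ_)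
open import Data.Bool.ListAction using (any)
open import Data.Unit using (tt)
open import Data.Empty using (⊥; ⊥-elim)
open import Data.Fin using (Fin)
open import Data.Fin.Properties using () renaming (_≟_ to _≟ᶠ_)
open import Data.Sum using (_⊎_; inj₁; inj₂; [_,_])
open import Data.Product using (Σ; _×_; _,_; proj₁; proj₂; ∃-syntax)
import Data.Product as Product
open import Data.List using (List; []; _∷_; _++_; map; filter; take; drop; zip; length; cartesianProduct; allFin)
open import Data.List.Properties
  using (length-++; length-map; length-removeAt′; length-take; length-drop; length-zipWith; length-tabulate;
         filter-++; take++drop≡id)
open import Data.List.Membership.Propositional using (_∈_; _∉_; find)
open import Data.List.Membership.Propositional.Properties
  using (∈-++⁺ˡ; ∈-++⁺ʳ; ∈-++⁻; ∈-map⁺; ∈-map⁻; ∈-filter⁺; ∈-filter⁻; ∈-allFin; ∈-cartesianProduct⁺; ∈-cartesianProduct⁻)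
open import Data.List.Relation.Binary.Subset.Propositional using (_⊆_)
open import Data.List.Relation.Binary.Disjoint.Propositional using (Disjoint)
open import Data.List.Relation.Unary.Any using (here; there; any?; index; _─_)
open import Data.List.Relation.Unary.Any.Properties using (any⁺; any⁻)
open import Data.List.Relation.Unary.All as All using (All; []; _∷_; all?)
open import Data.List.Relation.Unary.All.Properties using (¬Any⇒All¬; ¬All⇒Any¬)
open import Data.List.Relation.Unary.AllPairs using ([]; _∷_)
import Data.List.Relation.Unary.AllPairs as AllPairs
import Data.List.Relation.Unary.AllPairs.Properties as AllPairs
open import Data.List.Relation.Unary.Unique.Propositional using (Unique)
import Data.List.Relation.Unary.Unique.Propositional.Properties as Unique
open import Function using (_∘_; case_of_)
open import Level using (Level)
open import Relation.Binary.PropositionalEquality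
  using (_≡_; _≢_; refl; sym; trans; cong; cong₂; subst; module ≡-Reasoning)
open import Relation.Nullary using (¬_; Dec; yes; no; contradiction)
open import Relation.Unary using (Pred; Decidable)
open import Relation.Unary.Properties using (∁?)

private
  variable
    h : ℕ

_∈ᶠ?_ : (x : Fin h) (xs : List (Fin h)) → Dec (x ∈ xs)
x ∈ᶠ? xs = any? (x ≟ᶠ_) xs

Touch : Edge h → Edge h → Set
Touch e f = proj₁ e ≡ proj₁ f ⊎ proj₂ e ≡ proj₂ f

Apart : Edge h → Edge h → Set
Apart e f = proj₁ e ≢ proj₁ f × proj₂ e ≢ proj₂ f

touches⇒Touch : (e f : Edge h) → Bool.T (touches e f) → Touch e f
touches⇒Touch (a , b) (a′ , b′) t with a ≟ᶠ a′ | b ≟ᶠ b′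
... | yes a≡a′ | _        = inj₁ a≡a′
... | no _     | yes b≡b′ = inj₂ b≡b′

Touch⇒touches : (e f : Edge h) → Touch e f → Bool.T (touches e f)
Touch⇒touches (a , b) (a′ , b′) touch with a ≟ᶠ a′ | b ≟ᶠ b′
... | yes _    | _        = tt
... | no _     | yes _    = tt
... | no a≢a′  | no b≢b′  = [ a≢a′ , b≢b′ ] touch

¬touches⇒Apart : (e f : Edge h) → ¬ Bool.T (touches e f) → Apart e f
¬touches⇒Apart e f ¬t = (¬t ∘ Touch⇒touches e f ∘ inj₁) , (¬t ∘ Touch⇒touches e f ∘ inj₂)

any-touches⇒Touch : (e : Edge h) (M : List (Edge h)) →
                    any (touches e) M ≡ true → ∃[ m ] m ∈ M × Touch e m
any-touches⇒Touch e M eq with find (any⁻ (touches e) M (subst Bool.T (sym eq) tt))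
... | m , m∈M , t = m , m∈M , touches⇒Touch e m t

¬any-touches⇒Apart : (e : Edge h) (M : List (Edge h)) →
                     any (touches e) M ≡ false → All (Apart e) M
¬any-touches⇒Apart e M eq =
  All.map (¬touches⇒Apart e _) (¬Any⇒All¬ M (subst Bool.T eq ∘ any⁺ (touches e)))

greedyFrom-⊇ : (M L : List (Edge h)) → M ⊆ greedyFrom M L
greedyFrom-⊇ M []      m∈M = m∈M
greedyFrom-⊇ M (e ∷ L) m∈M with any (touches e) M
... | true  = greedyFrom-⊇ M L m∈M
... | false = greedyFrom-⊇ (e ∷ M) L (there m∈M)

∈-greedyFrom⁻ : (M L : List (Edge h)) {f : Edge h} → f ∈ greedyFrom M L →
                f ∈ M ⊎ (f ∈ L × All (Apart f) M)
∈-greedyFrom⁻ M []      f∈ = inj₁ f∈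
∈-greedyFrom⁻ M (e ∷ L) f∈ with any (touches e) M in eq
... | true with ∈-greedyFrom⁻ M L f∈
...   | inj₁ f∈M             = inj₁ f∈M
...   | inj₂ (f∈L , f-apart) = inj₂ (there f∈L , f-apart)
∈-greedyFrom⁻ M (e ∷ L) f∈ | false with ∈-greedyFrom⁻ (e ∷ M) L f∈
...   | inj₁ (here refl)     = inj₂ (here refl , ¬any-touches⇒Apart e M eq)
...   | inj₁ (there f∈M)     = inj₁ f∈M
...   | inj₂ (f∈L , f-apart) = inj₂ (there f∈L , All.tail f-apart)

greedyFrom-maximal : (M L : List (Edge h)) {e : Edge h} → e ∈ L →
                     ∃[ g ] g ∈ greedyFrom M L × Touch e g
greedyFrom-maximal M (e ∷ L) (here refl) with any (touches e) M in eq
... | true with any-touches⇒Touch e M eq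
...   | g , g∈M , touch = g , greedyFrom-⊇ M L g∈M , touch
greedyFrom-maximal M (e ∷ L) (here refl) | false =
  e , greedyFrom-⊇ (e ∷ M) L (here refl) , inj₁ refl
greedyFrom-maximal M (e ∷ L) (there e′∈L) with any (touches e) M
... | true  = greedyFrom-maximal M L e′∈L
... | false = greedyFrom-maximal (e ∷ M) L e′∈L

greedyFrom-isMatching : (M L : List (Edge h)) → IsMatching M → IsMatching (greedyFrom M L)
greedyFrom-isMatching M []      M-matching = M-matching
greedyFrom-isMatching M (e ∷ L) M-matching with any (touches e) M in eq
... | true  = greedyFrom-isMatching M L M-matching
... | false = greedyFrom-isMatching (e ∷ M) L (¬any-touches⇒Apart e M eq ∷ M-matching)

greedy-isMatching : (L : List (Edge h)) → IsMatching (greedy L)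
greedy-isMatching L = greedyFrom-isMatching [] L []

greedyFrom-++ : (M L L′ : List (Edge h)) → greedyFrom M (L ++ L′) ≡ greedyFrom (greedyFrom M L) L′
greedyFrom-++ M []      L′ = refl
greedyFrom-++ M (e ∷ L) L′ with any (touches e) M
... | true  = greedyFrom-++ M L L′
... | false = greedyFrom-++ (e ∷ M) L L′

module _ {A : Set} where

  ∈-─⁺ : ∀ {x y : A} {ys} (x∈ys : x ∈ ys) → y ∈ ys → y ≢ x → y ∈ (ys ─ x∈ys)
  ∈-─⁺ (here refl) (here refl) y≢x = contradiction refl y≢x
  ∈-─⁺ (here refl) (there y∈) y≢x  = y∈
  ∈-─⁺ (there x∈)  (here refl) y≢x = here refl
  ∈-─⁺ (there x∈)  (there y∈) y≢x  = there (∈-─⁺ x∈ y∈ y≢x)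

  Unique-⊆⇒length≤ : {xs ys : List A} → Unique xs → xs ⊆ ys → length xs ≤ length ys
  Unique-⊆⇒length≤ {[]}     _              _     = z≤n
  Unique-⊆⇒length≤ {x ∷ xs} {ys} (x∉xs ∷ xs-uniq) xs⊆ys =
    subst (suc (length xs) ≤_) (sym (length-removeAt′ ys (index x∈ys)))
      (s≤s (Unique-⊆⇒length≤ xs-uniq λ y∈xs → ∈-─⁺ x∈ys (xs⊆ys (there y∈xs)) (All.lookup x∉xs y∈xs ∘ sym)))
    where x∈ys = xs⊆ys (here refl)

  Unique-++⇒Disjoint : (xs : List A) {ys : List A} → Unique (xs ++ ys) → Disjoint xs ys
  Unique-++⇒Disjoint (x ∷ xs) (x∉ ∷ _) (here refl , x∈ys) = All.lookup x∉ (∈-++⁺ʳ xs x∈ys) refl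
  Unique-++⇒Disjoint (x ∷ xs) (_ ∷ u)  (there v∈xs , v∈ys) = Unique-++⇒Disjoint xs u (v∈xs , v∈ys)

  length-filter+filter-∁ : {p : Level} {P : Pred A p} (P? : Decidable P) (xs : List A) →
                           length (filter P? xs) + length (filter (∁? P?) xs) ≡ length xs
  length-filter+filter-∁ P? []       = refl
  length-filter+filter-∁ P? (x ∷ xs) with P? x
  ... | yes _ = cong suc (length-filter+filter-∁ P? xs)
  ... | no _  = trans (+-suc _ _) (cong suc (length-filter+filter-∁ P? xs))

  take-++-comparable : (k : ℕ) (xs ys : List A) → xs ⊆ take k (xs ++ ys) ⊎ take k (xs ++ ys) ⊆ xs
  take-++-comparable k       []       ys = inj₁ λ ()
  take-++-comparable zero    (x ∷ xs) ys = inj₂ λ ()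
  take-++-comparable (suc k) (x ∷ xs) ys with take-++-comparable k xs ys
  ... | inj₁ xs⊆ = inj₁ λ { (here refl) → here refl ; (there v∈) → there (xs⊆ v∈) }
  ... | inj₂ ⊆xs = inj₂ λ { (here refl) → here refl ; (there v∈) → there (⊆xs v∈) }

module _ {A : Set} {p : Level} {P : Pred A p} (P? : Decidable P) where

  arrange : List A → List A
  arrange xs = filter P? xs ++ filter (∁? P?) xs

  arrange-unique : {xs : List A} → Unique xs → Unique (arrange xs)
  arrange-unique {xs} xs-unique =
    Unique.++⁺ (Unique.filter⁺ P? xs-unique) (Unique.filter⁺ (∁? P?) xs-unique)
      λ (x∈₁ , x∈₂) → proj₂ (∈-filter⁻ (∁? P?) {xs = xs} x∈₂) (proj₂ (∈-filter⁻ P? {xs = xs} x∈₁))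

  length-arrange : (xs : List A) → length (arrange xs) ≡ length xs
  length-arrange xs = trans (length-++ (filter P? xs)) (length-filter+filter-∁ P? xs)

  take-arrange-comparable : (k : ℕ) (xs : List A) →
                            (∀ {x} → x ∈ xs → P x → x ∈ take k (arrange xs)) ⊎ (∀ {x} → x ∈ take k (arrange xs) → P x)
  take-arrange-comparable k xs with take-++-comparable k (filter P? xs) (filter (∁? P?) xs)
  ... | inj₁ filter⊆ = inj₁ λ x∈ px → filter⊆ (∈-filter⁺ P? x∈ px)
  ... | inj₂ ⊆filter = inj₂ λ x∈ → proj₂ (∈-filter⁻ P? {xs = xs} (⊆filter x∈))

module _ {A B : Set} where

  ∈-zip⁻ : {xs : List A} {ys : List B} {e : A × B} → e ∈ zip xs ys → proj₁ e ∈ xs × proj₂ e ∈ ys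
  ∈-zip⁻ {x ∷ xs} {y ∷ ys} (here refl) = here refl , here refl
  ∈-zip⁻ {x ∷ xs} {y ∷ ys} (there e∈) = Product.map there there (∈-zip⁻ e∈)

  length-zip : (xs : List A) (ys : List B) → length xs ≡ length ys → length (zip xs ys) ≡ length xs
  length-zip xs ys |xs|≡|ys| =
    trans (length-zipWith _,_ xs ys) (trans (cong (length xs ⊓_) (sym |xs|≡|ys|)) (⊓-idem (length xs)))

isMatching⇒Unique : {M : List (Edge h)} → IsMatching M → Unique M
isMatching⇒Unique = AllPairs.map λ (a≢a′ , _) e≡f → a≢a′ (cong proj₁ e≡f)

++-isMatching : {M M′ : List (Edge h)} → IsMatching M → IsMatching M′ →
                (∀ {e f} → e ∈ M → f ∈ M′ → Apart e f) → IsMatching (M ++ M′)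
++-isMatching M-matching M′-matching apart =
  AllPairs.++⁺ M-matching M′-matching (All.tabulate λ e∈ → All.tabulate (apart e∈))

matching-length≤ˡ : {M : List (Edge h)} {xs : List (Fin h)} → IsMatching M →
                    (∀ {e} → e ∈ M → proj₁ e ∈ xs) → length M ≤ length xs
matching-length≤ˡ {M = M} M-matching M⊆ =
  subst (_≤ _) (length-map proj₁ M)
    (Unique-⊆⇒length≤ (AllPairs.map⁺ (AllPairs.map proj₁ M-matching)) λ a∈ →
      case ∈-map⁻ proj₁ a∈ of λ { (e , e∈ , refl) → M⊆ e∈ })

matching-length≤ʳ : {M : List (Edge h)} {xs : List (Fin h)} → IsMatching M →
                    (∀ {e} → e ∈ M → proj₂ e ∈ xs) → length M ≤ length xs
matching-length≤ʳ {M = M} M-matching M⊆ =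
  subst (_≤ _) (length-map proj₂ M)
    (Unique-⊆⇒length≤ (AllPairs.map⁺ (AllPairs.map proj₂ M-matching)) λ b∈ →
      case ∈-map⁻ proj₂ b∈ of λ { (e , e∈ , refl) → M⊆ e∈ })

length-touched-matching≤ : {PM M : List (Edge h)} → IsMatching PM →
                           (∀ {e} → e ∈ PM → ∃[ g ] g ∈ M × Touch e g) → length PM ≤ 2 * length M
length-touched-matching≤ {PM = PM} {M} PM-matching touched = begin
  length PM
    ≡⟨ sym (length-filter+filter-∁ left-covered? PM) ⟩
  length (filter left-covered? PM) + length (filter (∁? left-covered?) PM)
    ≤⟨ +-mono-≤ (matching-length≤ˡ (AllPairs.filter⁺ left-covered? PM-matching) left-covered)
                (matching-length≤ʳ (AllPairs.filter⁺ (∁? left-covered?) PM-matching) right-covered) ⟩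
  length (map proj₁ M) + length (map proj₂ M)
    ≡⟨ cong₂ _+_ (length-map proj₁ M) (trans (length-map proj₂ M) (sym (+-identityʳ _))) ⟩
  2 * length M ∎
  where
  open ≤-Reasoning
  left-covered? : (e : Edge _) → Dec (proj₁ e ∈ map proj₁ M)
  left-covered? e = proj₁ e ∈ᶠ? map proj₁ M
  left-covered : ∀ {e} → e ∈ filter left-covered? PM → proj₁ e ∈ map proj₁ M
  left-covered e∈ = proj₂ (∈-filter⁻ left-covered? {xs = PM} e∈)
  right-covered : ∀ {e} → e ∈ filter (∁? left-covered?) PM → proj₂ e ∈ map proj₂ M
  right-covered e∈ with ∈-filter⁻ (∁? left-covered?) {xs = PM} e∈
  ... | e∈PM , a∉ with touched e∈PM
  ...   | g , g∈M , inj₁ a≡ = contradiction (subst (_∈ map proj₁ M) (sym a≡) (∈-map⁺ proj₁ g∈M)) a∉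
  ...   | g , g∈M , inj₂ b≡ = subst (_∈ map proj₂ M) (sym b≡) (∈-map⁺ proj₂ g∈M)

zip-isMatching : {xs ys : List (Fin h)} → Unique xs → Unique ys → IsMatching (zip xs ys)
zip-isMatching {xs = []}     {ys}     _ _ = []
zip-isMatching {xs = _ ∷ _}  {[]}     _ _ = []
zip-isMatching {xs = _ ∷ _}  {_ ∷ _}  (x∉ ∷ xs-unique) (y∉ ∷ ys-unique) =
  All.tabulate (λ e∈ → All.lookup x∉ (proj₁ (∈-zip⁻ e∈)) , All.lookup y∉ (proj₂ (∈-zip⁻ e∈)))
    ∷ zip-isMatching xs-unique ys-unique

selected? : (Q : Query h) → Decidable (λ e → inQuery Q e ≡ true)
selected? Q e = inQuery Q e ≟ᵇ true

selectAll : Query h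
selectAll _ = true

queryAll : Player h
queryAll = record { query₁ = selectAll ; query₂ = λ _ → selectAll }

queryAll-atLeastHalf : (O : Oracle h) → RatioAtLeastHalf queryAll O
queryAll-atLeastHalf O with Oracle.perfect O
... | PM , PM-matching , PM⊆π , |PM|≡h =
  M₁ queryAll O , (greedy-isMatching L , inj₁) ,
  subst (_≤ 2 * length (M₁ queryAll O)) |PM|≡h (length-touched-matching≤ PM-matching touched)
  where
  L = filter (selected? selectAll) (Oracle.π O)
  touched : ∀ {e} → e ∈ PM → ∃[ g ] g ∈ greedy L × Touch e g
  touched e∈PM = greedyFrom-maximal [] L (∈-filter⁺ (selected? selectAll) (PM⊆π e∈PM) refl)

Comparable : {A : Set} {p : Level} → Pred A p → List A → Set p
Comparable P xs = (∀ {x} → P x → x ∈ xs) ⊎ (∀ {x} → x ∈ xs → P x)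

module Stream (R T : List (Fin h)) (K₂ N : List (Edge h))
              (K₂-right : ∀ {e} → e ∈ K₂ → proj₂ e ∈ T)
              (N-left : ∀ {e} → e ∈ N → proj₁ e ∈ R) where

  stream : List (Edge h)
  stream = cartesianProduct R T ++ K₂ ++ N

  module _ (Q : Query h) where

    private
      sel = selected? Q

    L₁ L₂ L₃ F₁ F₂ F : List (Edge h)
    L₁ = filter sel (cartesianProduct R T)
    L₂ = filter sel K₂
    L₃ = filter sel N
    F₁ = greedy L₁
    F₂ = greedyFrom F₁ L₂
    F  = greedyFrom F₂ L₃

    answer-stream : answer stream Q ≡ F
    answer-stream = begin
      greedy (filter sel (cartesianProduct R T ++ K₂ ++ N))
        ≡⟨ cong greedy (filter-++ sel (cartesianProduct R T) (K₂ ++ N)) ⟩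
      greedy (L₁ ++ filter sel (K₂ ++ N))
        ≡⟨ cong (λ L → greedy (L₁ ++ L)) (filter-++ sel K₂ N) ⟩
      greedy (L₁ ++ L₂ ++ L₃)
        ≡⟨ greedyFrom-++ [] L₁ (L₂ ++ L₃) ⟩
      greedyFrom F₁ (L₂ ++ L₃)
        ≡⟨ greedyFrom-++ F₁ L₂ L₃ ⟩
      F ∎
      where open ≡-Reasoning

    selected-ends : ∀ {xs e} → e ∈ filter sel xs → Q (inj₁ (proj₁ e)) ≡ true × Q (inj₂ (proj₂ e)) ≡ true
    selected-ends {xs} e∈ = ∧-conicalˡ _ _ e-sel , ∧-conicalʳ _ _ e-sel
      where e-sel = proj₂ (∈-filter⁻ sel {xs = xs} e∈)

    L₁-complete : ∀ {r t} → r ∈ R → t ∈ T → Q (inj₁ r) ≡ true → Q (inj₂ t) ≡ true → (r , t) ∈ L₁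
    L₁-complete r∈R t∈T r-sel t-sel = ∈-filter⁺ sel (∈-cartesianProduct⁺ r∈R t∈T) (cong₂ _∧_ r-sel t-sel)

    F₁-ends : ∀ {e} → e ∈ F₁ → proj₁ e ∈ R × proj₂ e ∈ T
    F₁-ends e∈ with ∈-greedyFrom⁻ [] L₁ e∈
    ... | inj₂ (e∈L₁ , _) = ∈-cartesianProduct⁻ R T (proj₁ (∈-filter⁻ sel {xs = cartesianProduct R T} e∈L₁))

    L₂-right : ∀ {e} → e ∈ L₂ → proj₂ e ∈ T
    L₂-right e∈ = K₂-right (proj₁ (∈-filter⁻ sel {xs = K₂} e∈))

    L₃-left : ∀ {e} → e ∈ L₃ → proj₁ e ∈ R
    L₃-left e∈ = N-left (proj₁ (∈-filter⁻ sel {xs = N} e∈))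

    F₂-right : ∀ {e} → e ∈ F₂ → proj₂ e ∈ T
    F₂-right e∈ with ∈-greedyFrom⁻ F₁ L₂ e∈
    ... | inj₁ e∈F₁       = proj₂ (F₁-ends e∈F₁)
    ... | inj₂ (e∈L₂ , _) = L₂-right e∈L₂

    right-escape : ∀ {e} → e ∈ F → proj₂ e ∉ T → e ∈ L₃ × All (Apart e) F₁
    right-escape e∈ b∉T with ∈-greedyFrom⁻ F₂ L₃ e∈
    ... | inj₁ e∈F₂                = contradiction (F₂-right e∈F₂) b∉T
    ... | inj₂ (e∈L₃ , e-apart-F₂) = e∈L₃ , All.tabulate (All.lookup e-apart-F₂ ∘ greedyFrom-⊇ F₁ L₂)

    left-escape : ∀ {e} → e ∈ F → proj₁ e ∉ R → e ∈ L₂ × All (Apart e) F₁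
    left-escape e∈ a∉R with ∈-greedyFrom⁻ F₂ L₃ e∈
    ... | inj₂ (e∈L₃ , _) = contradiction (L₃-left e∈L₃) a∉R
    ... | inj₁ e∈F₂ with ∈-greedyFrom⁻ F₁ L₂ e∈F₂
    ...   | inj₁ e∈F₁ = contradiction (proj₁ (F₁-ends e∈F₁)) a∉R
    ...   | inj₂ escape = escape

    -- Greedy saw the edge from the R-end of f to the T-end of e in the first phase.
    no-two-escapes : ∀ {f e} → f ∈ L₃ × All (Apart f) F₁ → e ∈ L₂ × All (Apart e) F₁ → ⊥
    no-two-escapes (f∈L₃ , f-apart) (e∈L₂ , e-apart)
      with greedyFrom-maximal [] L₁ (L₁-complete (L₃-left f∈L₃) (L₂-right e∈L₂)
                                                 (proj₁ (selected-ends {N} f∈L₃)) (proj₂ (selected-ends {K₂} e∈L₂)))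
    ... | g , g∈F₁ , inj₁ a≡ = proj₁ (All.lookup f-apart g∈F₁) a≡
    ... | g , g∈F₁ , inj₂ b≡ = proj₂ (All.lookup e-apart g∈F₁) b≡

    answer-confined : (∀ {e} → e ∈ answer stream Q → proj₂ e ∈ T) ⊎ (∀ {e} → e ∈ answer stream Q → proj₁ e ∈ R)
    answer-confined rewrite answer-stream with all? (λ e → proj₂ e ∈ᶠ? T) F
    ... | yes all-right = inj₁ (All.lookup all-right)
    ... | no ¬all-right with find (¬All⇒Any¬ (λ e → proj₂ e ∈ᶠ? T) F ¬all-right)
    ...   | f , f∈F , b∉T = inj₂ λ {e} e∈F → case proj₁ e ∈ᶠ? R of λ where
            (yes a∈R) → a∈R
            (no a∉R)  → ⊥-elim (no-two-escapes (right-escape f∈F b∉T) (left-escape e∈F a∉R))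

  module Balanced (R-unique : Unique R) (T-unique : Unique T) (|R|≡|T| : length R ≡ length T)
                  (Q : Query h) where

    right-escape⇒|T|<|R| : ∀ {f} → f ∈ L₃ Q × All (Apart f) (F₁ Q) →
                          (∀ {t} → t ∈ T → Q (inj₂ t) ≡ true) → length T < length R
    right-escape⇒|T|<|R| {f} (f∈L₃ , f-apart) T-selected = begin-strict
      length T                   ≤⟨ Unique-⊆⇒length≤ T-unique T-matched ⟩
      length (map proj₂ (F₁ Q))  ≡⟨ length-map proj₂ (F₁ Q) ⟩
      length (F₁ Q)              <⟨ matching-length≤ˡ (f-apart ∷ greedy-isMatching (L₁ Q)) lefts-in-R ⟩
      length R                   ∎
      where
      open ≤-Reasoning
      T-matched : T ⊆ map proj₂ (F₁ Q)
      T-matched t∈T with greedyFrom-maximal [] (L₁ Q)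
                           (L₁-complete Q (L₃-left Q f∈L₃) t∈T (proj₁ (selected-ends Q {N} f∈L₃)) (T-selected t∈T))
      ... | g , g∈F₁ , inj₁ a≡ = contradiction a≡ (proj₁ (All.lookup f-apart g∈F₁))
      ... | g , g∈F₁ , inj₂ t≡ = subst (_∈ map proj₂ (F₁ Q)) (sym t≡) (∈-map⁺ proj₂ g∈F₁)
      lefts-in-R : ∀ {e} → e ∈ f ∷ F₁ Q → proj₁ e ∈ R
      lefts-in-R (here refl) = L₃-left Q f∈L₃
      lefts-in-R (there e∈)  = proj₁ (F₁-ends Q e∈)

    left-escape⇒|R|<|T| : ∀ {f} → f ∈ L₂ Q × All (Apart f) (F₁ Q) →
                          (∀ {r} → r ∈ R → Q (inj₁ r) ≡ true) → length R < length T
    left-escape⇒|R|<|T| {f} (f∈L₂ , f-apart) R-selected = begin-strict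
      length R                   ≤⟨ Unique-⊆⇒length≤ R-unique R-matched ⟩
      length (map proj₁ (F₁ Q))  ≡⟨ length-map proj₁ (F₁ Q) ⟩
      length (F₁ Q)              <⟨ matching-length≤ʳ (f-apart ∷ greedy-isMatching (L₁ Q)) rights-in-T ⟩
      length T                   ∎
      where
      open ≤-Reasoning
      R-matched : R ⊆ map proj₁ (F₁ Q)
      R-matched r∈R with greedyFrom-maximal [] (L₁ Q)
                           (L₁-complete Q r∈R (L₂-right Q f∈L₂) (R-selected r∈R) (proj₂ (selected-ends Q {K₂} f∈L₂)))
      ... | g , g∈F₁ , inj₁ r≡ = subst (_∈ map proj₁ (F₁ Q)) (sym r≡) (∈-map⁺ proj₁ g∈F₁)
      ... | g , g∈F₁ , inj₂ b≡ = contradiction b≡ (proj₂ (All.lookup f-apart g∈F₁))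
      rights-in-T : ∀ {e} → e ∈ f ∷ F₁ Q → proj₂ e ∈ T
      rights-in-T (here refl) = L₂-right Q f∈L₂
      rights-in-T (there e∈)  = proj₂ (F₁-ends Q e∈)

    F-right : Comparable (λ t → Q (inj₂ t) ≡ true) T → ∀ {e} → e ∈ F Q → proj₂ e ∈ T
    F-right T-comparable {e} e∈F with proj₂ e ∈ᶠ? T
    ... | yes b∈T = b∈T
    F-right (inj₁ selected⊆T) e∈F | no b∉T =
      selected⊆T (proj₂ (selected-ends Q {N} (proj₁ (right-escape Q e∈F b∉T))))
    F-right (inj₂ T⊆selected) e∈F | no b∉T =
      ⊥-elim (<-irrefl (sym |R|≡|T|) (right-escape⇒|T|<|R| (right-escape Q e∈F b∉T) T⊆selected))

    F-left : Comparable (λ r → Q (inj₁ r) ≡ true) R → ∀ {e} → e ∈ F Q → proj₁ e ∈ R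
    F-left R-comparable {e} e∈F with proj₁ e ∈ᶠ? R
    ... | yes a∈R = a∈R
    F-left (inj₁ selected⊆R) e∈F | no a∉R =
      selected⊆R (proj₁ (selected-ends Q {K₂} (proj₁ (left-escape Q e∈F a∉R))))
    F-left (inj₂ R⊆selected) e∈F | no a∉R =
      ⊥-elim (<-irrefl |R|≡|T| (left-escape⇒|R|<|T| (left-escape Q e∈F a∉R) R⊆selected))

    answer-within-block : Comparable (λ r → Q (inj₁ r) ≡ true) R → Comparable (λ t → Q (inj₂ t) ≡ true) T →
                          ∀ {e} → e ∈ answer stream Q → proj₁ e ∈ R × proj₂ e ∈ T
    answer-within-block R-comparable T-comparable e∈ rewrite answer-stream Q =
      F-left R-comparable e∈ , F-right T-comparable e∈

record Halves (A : Set) (k : ℕ) : Set where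
  field
    lower upper          : List A
    lower-unique         : Unique lower
    upper-unique         : Unique upper
    lower-upper-disjoint : Disjoint lower upper
    length-lower         : length lower ≡ k
    length-upper         : length upper ≡ k

halve : {A : Set} (k : ℕ) (xs : List A) → Unique xs → length xs ≡ 2 * k → Halves A k
halve k xs xs-unique |xs| = record
  { lower                = take k xs
  ; upper                = drop k xs
  ; lower-unique         = Unique.take⁺ k xs-unique
  ; upper-unique         = Unique.drop⁺ k xs-unique
  ; lower-upper-disjoint = Unique-++⇒Disjoint (take k xs) (subst Unique (sym (take++drop≡id k xs)) xs-unique)
  ; length-lower         = trans (length-take k xs) (trans (cong (k ⊓_) |xs|) (m≤n⇒m⊓n≡m (m≤m+n k (k + 0))))
  ; length-upper         = trans (length-drop k xs) (trans (cong (_∸ k) |xs|) (trans (m+n∸m≡n k (k + 0)) (+-identityʳ k)))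
  }

module _ {k : ℕ} {p : Level} {P : Pred (Fin (2 * k)) p} (P? : Decidable P) where

  halveBy : Halves (Fin (2 * k)) k
  halveBy = halve k (arrange P? (allFin (2 * k))) (arrange-unique P? (Unique.allFin⁺ (2 * k)))
                  (trans (length-arrange P? (allFin (2 * k))) (length-tabulate (λ x → x)))

  halveBy-comparable : Comparable P (Halves.lower halveBy)
  halveBy-comparable with take-arrange-comparable P? k (allFin (2 * k))
  ... | inj₁ P⊆lower = inj₁ λ {x} px → P⊆lower (∈-allFin x) px
  ... | inj₂ lower⊆P = inj₂ lower⊆P

module HardInstance {k : ℕ} (A-halves B-halves : Halves (Fin (2 * k)) k) where

  open Halves A-halves public using () renaming
    (lower to R; upper to S; lower-unique to R-unique; upper-unique to S-unique;
     lower-upper-disjoint to R#S; length-lower to |R|; length-upper to |S|)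
  open Halves B-halves public using () renaming
    (lower to T; upper to U; lower-unique to T-unique; upper-unique to U-unique;
     lower-upper-disjoint to T#U; length-lower to |T|; length-upper to |U|)

  K₂ N : List (Edge (2 * k))
  K₂ = cartesianProduct S T
  N  = zip R U

  open Stream R T K₂ N (proj₂ ∘ ∈-cartesianProduct⁻ S T) (proj₁ ∘ ∈-zip⁻) public

  stream-unique : Unique stream
  stream-unique =
    Unique.++⁺ (Unique.cartesianProduct⁺ R-unique T-unique)
      (Unique.++⁺ (Unique.cartesianProduct⁺ S-unique T-unique) (isMatching⇒Unique (zip-isMatching R-unique U-unique)) K₂#N)
      K₁#K₂N
    where
    K₂#N : Disjoint K₂ N
    K₂#N (e∈K₂ , e∈N) = T#U (proj₂ (∈-cartesianProduct⁻ S T e∈K₂) , proj₂ (∈-zip⁻ e∈N))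
    K₁#K₂N : Disjoint (cartesianProduct R T) (K₂ ++ N)
    K₁#K₂N (e∈K₁ , e∈K₂N) with ∈-++⁻ K₂ e∈K₂N
    ... | inj₁ e∈K₂ = R#S (proj₁ (∈-cartesianProduct⁻ R T e∈K₁) , proj₁ (∈-cartesianProduct⁻ S T e∈K₂))
    ... | inj₂ e∈N  = T#U (proj₂ (∈-cartesianProduct⁻ R T e∈K₁) , proj₂ (∈-zip⁻ e∈N))

  perfectMatching : List (Edge (2 * k))
  perfectMatching = zip R U ++ zip S T

  perfectMatching-isMatching : IsMatching perfectMatching
  perfectMatching-isMatching =
    ++-isMatching (zip-isMatching R-unique U-unique) (zip-isMatching S-unique T-unique) λ e∈ f∈ →
      (λ a≡ → R#S (subst (_∈ R) a≡ (proj₁ (∈-zip⁻ e∈)) , proj₁ (∈-zip⁻ f∈))) ,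
      (λ b≡ → T#U (proj₂ (∈-zip⁻ f∈) , subst (_∈ U) b≡ (proj₂ (∈-zip⁻ e∈))))

  perfectMatching⊆stream : perfectMatching ⊆ stream
  perfectMatching⊆stream e∈ with ∈-++⁻ (zip R U) e∈
  ... | inj₁ e∈N  = ∈-++⁺ʳ (cartesianProduct R T) (∈-++⁺ʳ K₂ e∈N)
  ... | inj₂ e∈ST = ∈-++⁺ʳ (cartesianProduct R T) (∈-++⁺ˡ (Product.uncurry ∈-cartesianProduct⁺ (∈-zip⁻ e∈ST)))

  length-perfectMatching : length perfectMatching ≡ 2 * k
  length-perfectMatching = begin
    length (zip R U ++ zip S T)          ≡⟨ length-++ (zip R U) ⟩
    length (zip R U) + length (zip S T)  ≡⟨ cong₂ _+_ (length-zip R U (trans |R| (sym |U|))) (length-zip S T (trans |S| (sym |T|))) ⟩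
    length R + length S                  ≡⟨ cong₂ _+_ |R| (trans |S| (sym (+-identityʳ k))) ⟩
    2 * k                                ∎
    where open ≡-Reasoning

  oracle : Oracle (2 * k)
  oracle = record
    { π        = stream
    ; distinct = stream-unique
    ; perfect  = perfectMatching , perfectMatching-isMatching , perfectMatching⊆stream , length-perfectMatching
    }

lowerBound : (k : ℕ) (P : Player (2 * k)) → Σ (Oracle (2 * k)) λ O → RatioAtMostHalf P O
lowerBound k P = oracle , reported-bound
  where
  open Player P
  A-selected? = λ a → query₁ (inj₁ a) ≟ᵇ true
  B-selected? = λ b → query₁ (inj₂ b) ≟ᵇ true
  open HardInstance (halveBy {k} A-selected?) (halveBy {k} B-selected?)

  M₁-within-block : ∀ {e} → e ∈ M₁ P oracle → proj₁ e ∈ R × proj₂ e ∈ T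
  M₁-within-block = Balanced.answer-within-block R-unique T-unique (trans |R| (sym |T|)) query₁
                      (halveBy-comparable {k} A-selected?) (halveBy-comparable {k} B-selected?)

  reported-bound : RatioAtMostHalf P oracle
  reported-bound M (M-matching , M⊆M₁∪M₂) = *-monoʳ-≤ 2 {length M} {k} M-bound
    where
    M-bound : length M ≤ k
    M-bound with answer-confined (query₂ _)
    ... | inj₁ M₂-right = subst (length M ≤_) |T| (matching-length≤ʳ {xs = T} M-matching λ e∈ →
            [ (λ e∈M₁ → proj₂ (M₁-within-block e∈M₁)) , M₂-right ] (M⊆M₁∪M₂ e∈))
    ... | inj₂ M₂-left  = subst (length M ≤_) |R| (matching-length≤ˡ {xs = R} M-matching λ e∈ →
            [ (λ e∈M₁ → proj₁ (M₁-within-block e∈M₁)) , M₂-left ] (M⊆M₁∪M₂ e∈))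

mainTheorem1 : (k' : ℕ) →
    ((P : Player (2 * suc k')) → Σ (Oracle (2 * suc k')) λ O → RatioAtMostHalf P O)
    × Σ (Player (2 * suc k')) (λ P → (O : Oracle (2 * suc k')) → RatioAtLeastHalf P O)
mainTheorem1 k' = lowerBound (suc k') , queryAll , queryAll-atLeastHalf
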